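{- Let $r$ be a positive integer and let $\mathbb{M}=(V,\mathcal{C})$ be the rank-$r$ uniform matroid on $n=|V|\ge r$ elements, i.e. $\mathcal{C}=\{C\subseteq V: |C|=r+1\}$. Then the minimum cardinality of a generator of $\mathcal{C}$ is $n-r$.
   Context: For $\mathcal{F}\subseteq 2^V$ and $\mathcal{G}\subseteq\mathcal{F}$, let $\langle\mathcal{G}\rangle^1_{\mathcal{F}}=\mathcal{G}\cup\{X\in\mathcal{F}: X=(X_1\cup X_2)\setminus\{v\}$ for distinct $X_1,X_2\in\mathcal{G}$ and $v\in X_1\cap X_2\}$; iterate until stable to obtain $\langle\mathcal{G}\rangle_{\mathcal{F}}$; $\mathcal{G}$ is a generator of $\mathcal{F}$ if $\langle\mathcal{G}\rangle_{\mathcal{F}}=\mathcal{F}$. -}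

module Defs where

open import Data.Nat using (ℕ; zero; suc; _≤_; _∸_)
open import Data.Fin using (Fin)
open import Data.Fin.Subset using (Subset; _∪_; _∩_; _-_; ∣_∣) renaming (_∈_ to _∈ₛ_)
open import Data.List using (List; length)
open import Data.List.Membership.Propositional using (_∈_)
open import Data.List.Relation.Unary.All using (All)
open import Data.List.Relation.Unary.Unique.Propositional using (Unique)
open import Data.Product using (Σ; ∃; _×_; _,_)
open import Data.Sum using (_⊎_)
open import Relation.Binary.PropositionalEquality using (_≡_; _≢_)
open import Relation.Nullary using (¬_)

Family : ℕ → Set₁
Family n = Subset n → Set

Step : ∀ {n} → Family n → Family n → Family n
Step {n} F P X =
  F X × Σ (Subset n) λ X₁ → Σ (Subset n) λ X₂ → Σ (Fin n) λ v →
    P X₁ × P X₂ × X₁ ≢ X₂ × v ∈ₛ (X₁ ∩ X₂) × X ≡ (X₁ ∪ X₂) - v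

Iter : ∀ {n} → Family n → Family n → ℕ → Family n
Iter F G zero X = G X
Iter F G (suc k) X = Iter F G k X ⊎ Step F (Iter F G k) X

-- ⟨G⟩_F : the stable value of the iteration (= union of all iterates, the sequence
-- being increasing).
Closure : ∀ {n} → Family n → Family n → Family n
Closure F G X = ∃ λ k → Iter F G k X

-- A finite family given as a duplicate-free list (so its cardinality is its length).
ListFam : ∀ {n} → List (Subset n) → Family n
ListFam G X = X ∈ G

IsGenerator : ∀ {n} → Family n → List (Subset n) → Set
IsGenerator F G =
  Unique G × All F G ×
  (∀ X → Closure F (ListFam G) X → F X) × (∀ X → F X → Closure F (ListFam G) X)

UniformCircuits : (n r : ℕ) → Family n
UniformCircuits n r C = ∣ C ∣ ≡ suc r

{-# OPTIONS --safe #-}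
-- Fix an r-set S. The n − r circuits S ∪ {a}, a ∉ S, generate every circuit X: if X
-- misses a point v of S, pick a ≠ b in X ∖ S; then X = ((X + v − a) ∪ (X + v − b)) − v,
-- and both circuits on the right miss fewer points of S.
--
-- Conversely, let a set B have excess |B| − r. Inserting the members of a generator G
-- one at a time, and merging blocks that meet in at least r points, gives a sparse list
-- of blocks (any two meet in fewer than r points) of total excess at most |G|, since a
-- merge never increases excess. An elimination step combines two circuits meeting in
-- exactly r points, hence lying in one block, so every generated circuit lies in a block.
-- As all circuits are generated, the blocks through a fixed r-set S coincide, and they
-- contain all n points since every point lies on a circuit through S; so n − r ≤ |G|.

module Submission where

open import Defs
open import Data.Empty using (⊥-elim)
open import Data.Fin using (Fin; zero; suc)
open import Data.Fin.Properties using () renaming (suc-injective to fsuc-injective; _≟_ to _≟ᶠ_)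
open import Data.Fin.Subset
  renaming (_∈_ to _∈ₛ_; _∉_ to _∉ₛ_; ⊥ to ∅)
open import Data.Fin.Subset.Properties
open import Data.List using (List; []; _∷_; length; map; allFin)
open import Data.List.Membership.Propositional using (_∈_)
open import Data.List.Membership.Propositional.Properties using (∈-map⁺; ∈-map⁻; ∈-allFin)
open import Data.List.Properties using (length-map)
open import Data.List.Relation.Unary.All as All using (All; []; _∷_)
import Data.List.Relation.Unary.All.Properties as Allₚ
open import Data.List.Relation.Unary.AllPairs using (AllPairs; []; _∷_)
import Data.List.Relation.Unary.AllPairs.Properties as AllPairs
open import Data.List.Relation.Unary.Any as Any using (Any; here; there)
open import Data.List.Relation.Unary.Unique.Propositional using (Unique)
import Data.List.Relation.Unary.Unique.Propositional.Properties as Unique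
open import Data.Nat using (ℕ; zero; suc; _+_; _∸_; _≤_; _<_; z≤n; s≤s; _≤?_)
open import Data.Nat.ListAction using (sum)
open import Data.Nat.Properties
open import Algebra.Properties.CommutativeSemigroup +-commutativeSemigroup using (x∙yz≈y∙xz)
open import Data.Product using (Σ; ∃; _×_; _,_; proj₁; proj₂)
open import Data.Vec using ([]; _∷_; here; there)
open import Data.Sum using (_⊎_; inj₁; inj₂; [_,_]; map₂)
open import Function using (_∘_; id)
open import Relation.Binary.PropositionalEquality hiding ([_])
open import Relation.Nullary using (yes; no)

-- Cardinalities of subsets

∣p∪q∣+∣p∩q∣≡∣p∣+∣q∣ : ∀ {n} (p q : Subset n) → ∣ p ∪ q ∣ + ∣ p ∩ q ∣ ≡ ∣ p ∣ + ∣ q ∣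
∣p∪q∣+∣p∩q∣≡∣p∣+∣q∣ [] [] = refl
∣p∪q∣+∣p∩q∣≡∣p∣+∣q∣ (inside ∷ p) (inside ∷ q) =
  cong suc (trans (+-suc _ _) (trans (cong suc (∣p∪q∣+∣p∩q∣≡∣p∣+∣q∣ p q)) (sym (+-suc _ _))))
∣p∪q∣+∣p∩q∣≡∣p∣+∣q∣ (inside ∷ p) (outside ∷ q) = cong suc (∣p∪q∣+∣p∩q∣≡∣p∣+∣q∣ p q)
∣p∪q∣+∣p∩q∣≡∣p∣+∣q∣ (outside ∷ p) (inside ∷ q) =
  trans (cong suc (∣p∪q∣+∣p∩q∣≡∣p∣+∣q∣ p q)) (sym (+-suc _ _))
∣p∪q∣+∣p∩q∣≡∣p∣+∣q∣ (outside ∷ p) (outside ∷ q) = ∣p∪q∣+∣p∩q∣≡∣p∣+∣q∣ p q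

∣p∪q∣≡∣p∩∁q∣+∣q∣ : ∀ {n} (p q : Subset n) → ∣ p ∪ q ∣ ≡ ∣ p ∩ ∁ q ∣ + ∣ q ∣
∣p∪q∣≡∣p∩∁q∣+∣q∣ [] [] = refl
∣p∪q∣≡∣p∩∁q∣+∣q∣ (inside ∷ p) (inside ∷ q) = trans (cong suc (∣p∪q∣≡∣p∩∁q∣+∣q∣ p q)) (sym (+-suc _ _))
∣p∪q∣≡∣p∩∁q∣+∣q∣ (inside ∷ p) (outside ∷ q) = cong suc (∣p∪q∣≡∣p∩∁q∣+∣q∣ p q)
∣p∪q∣≡∣p∩∁q∣+∣q∣ (outside ∷ p) (inside ∷ q) = trans (cong suc (∣p∪q∣≡∣p∩∁q∣+∣q∣ p q)) (sym (+-suc _ _))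
∣p∪q∣≡∣p∩∁q∣+∣q∣ (outside ∷ p) (outside ∷ q) = ∣p∪q∣≡∣p∩∁q∣+∣q∣ p q

∣p∩∁q∣+∣q∣≡∣q∩∁p∣+∣p∣ : ∀ {n} (p q : Subset n) → ∣ p ∩ ∁ q ∣ + ∣ q ∣ ≡ ∣ q ∩ ∁ p ∣ + ∣ p ∣
∣p∩∁q∣+∣q∣≡∣q∩∁p∣+∣p∣ p q = begin
  ∣ p ∩ ∁ q ∣ + ∣ q ∣  ≡⟨ ∣p∪q∣≡∣p∩∁q∣+∣q∣ p q ⟨
  ∣ p ∪ q ∣            ≡⟨ cong ∣_∣ (∪-comm p q) ⟩
  ∣ q ∪ p ∣            ≡⟨ ∣p∪q∣≡∣p∩∁q∣+∣q∣ q p ⟩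
  ∣ q ∩ ∁ p ∣ + ∣ p ∣  ∎
  where open ≡-Reasoning

x∈p⇒suc∣p-x∣≡∣p∣ : ∀ {n} {x : Fin n} {p} → x ∈ₛ p → suc ∣ p - x ∣ ≡ ∣ p ∣
x∈p⇒suc∣p-x∣≡∣p∣ {p = inside ∷ p} here = cong (suc ∘ ∣_∣) (p─⊥≡p p)
x∈p⇒suc∣p-x∣≡∣p∣ {x = suc x} {p = inside ∷ p} (there x∈p) = cong suc (x∈p⇒suc∣p-x∣≡∣p∣ x∈p)
x∈p⇒suc∣p-x∣≡∣p∣ {x = suc x} {p = outside ∷ p} (there x∈p) = x∈p⇒suc∣p-x∣≡∣p∣ x∈p

x∉p⇒∣p∪⁅x⁆∣≡suc∣p∣ : ∀ {n} {x : Fin n} {p} → x ∉ₛ p → ∣ p ∪ ⁅ x ⁆ ∣ ≡ suc ∣ p ∣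
x∉p⇒∣p∪⁅x⁆∣≡suc∣p∣ {x = zero} {inside ∷ p} x∉p = ⊥-elim (x∉p here)
x∉p⇒∣p∪⁅x⁆∣≡suc∣p∣ {x = zero} {outside ∷ p} _ = cong (suc ∘ ∣_∣) (∪-identityʳ p)
x∉p⇒∣p∪⁅x⁆∣≡suc∣p∣ {x = suc x} {inside ∷ p} x∉p = cong suc (x∉p⇒∣p∪⁅x⁆∣≡suc∣p∣ (x∉p ∘ there))
x∉p⇒∣p∪⁅x⁆∣≡suc∣p∣ {x = suc x} {outside ∷ p} x∉p = x∉p⇒∣p∪⁅x⁆∣≡suc∣p∣ (x∉p ∘ there)

x∈p-y⇒x≢y : ∀ {n} {x y : Fin n} {p} → x ∈ₛ p - y → x ≢ y
x∈p-y⇒x≢y {x = x} x∈p-y refl = go x∈p-y (x∈⁅x⁆ x)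
  where
  go : ∀ {n} {x : Fin n} {p q} → x ∈ₛ p ─ q → x ∉ₛ q
  go {p = inside ∷ p} {outside ∷ q} here ()
  go {p = _ ∷ p} {_ ∷ q} (there x∈p─q) (there x∈q) = go x∈p─q x∈q

0<∣p∣⇒Nonempty : ∀ {n} {p : Subset n} → 0 < ∣ p ∣ → Nonempty p
0<∣p∣⇒Nonempty {n} {p} 0<∣p∣ with nonempty? p
... | yes ne = ne
... | no ¬ne = ⊥-elim (<⇒≢ 0<∣p∣ (sym (trans (cong ∣_∣ (Empty-unique ¬ne)) (∣⊥∣≡0 n))))

∣p∩∁q∣≡0⇒p⊆q : ∀ {n} {p q : Subset n} → ∣ p ∩ ∁ q ∣ ≡ 0 → p ⊆ q
∣p∩∁q∣≡0⇒p⊆q {q = q} ∣p∩∁q∣≡0 {x} x∈p with x ∈? q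
... | yes x∈q = x∈q
... | no x∉q = ⊥-elim (1+n≢0 (trans (x∈p⇒suc∣p-x∣≡∣p∣ (x∈p∩q⁺ (x∈p , x∉p⇒x∈∁p x∉q))) ∣p∩∁q∣≡0))

p⊆q⇒∣q∣≤∣p∣⇒p≡q : ∀ {n} {p q : Subset n} → p ⊆ q → ∣ q ∣ ≤ ∣ p ∣ → p ≡ q
p⊆q⇒∣q∣≤∣p∣⇒p≡q {p = p} {q} p⊆q ∣q∣≤∣p∣ = ⊆-antisym p⊆q q⊆p
  where
  q⊆p : q ⊆ p
  q⊆p {x} x∈q with x ∈? p
  ... | yes x∈p = x∈p
  ... | no x∉p = ⊥-elim (<⇒≱ (≤-<-trans (p⊆q⇒∣p∣≤∣q∣ p⊆q-x) (x∈p⇒∣p-x∣<∣p∣ x∈q)) ∣q∣≤∣p∣)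
    where
    p⊆q-x : p ⊆ q - x
    p⊆q-x y∈p = x∈p∧x≢y⇒x∈p-y (p⊆q y∈p) (λ { refl → x∉p y∈p })

two-elements : ∀ {n} {p : Subset n} → 2 ≤ ∣ p ∣ → ∃ λ a → ∃ λ b → a ∈ₛ p × b ∈ₛ p × a ≢ b
two-elements {p = p} 2≤∣p∣ with 0<∣p∣⇒Nonempty {p = p} (≤-trans (s≤s z≤n) 2≤∣p∣)
... | a , a∈p with 0<∣p∣⇒Nonempty {p = p - a} (≤-pred (subst (2 ≤_) (sym (x∈p⇒suc∣p-x∣≡∣p∣ a∈p)) 2≤∣p∣))
...   | b , b∈p-a = a , b , a∈p , p─q⊆p p ⁅ a ⁆ b∈p-a , ≢-sym (x∈p-y⇒x≢y b∈p-a)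

∃-∣p∣≡k : ∀ {n k} → k ≤ n → ∃ λ (p : Subset n) → ∣ p ∣ ≡ k
∃-∣p∣≡k {n} z≤n = ∅ , ∣⊥∣≡0 n
∃-∣p∣≡k (s≤s k≤n) with ∃-∣p∣≡k k≤n
... | p , ∣p∣≡k = inside ∷ p , cong suc ∣p∣≡k

∪-least : ∀ {n} {p q r : Subset n} → p ⊆ r → q ⊆ r → p ∪ q ⊆ r
∪-least {p = p} {q} p⊆r q⊆r x∈ with x∈p∪q⁻ p q x∈
... | inj₁ x∈p = p⊆r x∈p
... | inj₂ x∈q = q⊆r x∈q

p-x∪p-y≡p : ∀ {n} (p : Subset n) {x y} → x ≢ y → (p - x) ∪ (p - y) ≡ p
p-x∪p-y≡p p {x} {y} x≢y = ⊆-antisym ⊆p p⊆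
  where
  ⊆p : (p - x) ∪ (p - y) ⊆ p
  ⊆p = ∪-least (p─q⊆p p ⁅ x ⁆) (p─q⊆p p ⁅ y ⁆)
  p⊆ : p ⊆ (p - x) ∪ (p - y)
  p⊆ {z} z∈p with z ≟ᶠ x
  ... | yes refl = q⊆p∪q (p - x) (p - y) (x∈p∧x≢y⇒x∈p-y z∈p x≢y)
  ... | no z≢x = p⊆p∪q (p - y) (x∈p∧x≢y⇒x∈p-y z∈p z≢x)

x∉p⇒[p∪⁅x⁆]-x≡p : ∀ {n} {x : Fin n} {p} → x ∉ₛ p → (p ∪ ⁅ x ⁆) - x ≡ p
x∉p⇒[p∪⁅x⁆]-x≡p {x = x} {p} x∉p = ⊆-antisym ⊆p p⊆
  where
  ⊆p : (p ∪ ⁅ x ⁆) - x ⊆ p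
  ⊆p z∈ = [ id , (λ z∈⁅x⁆ → ⊥-elim (x∈p-y⇒x≢y z∈ (x∈⁅y⁆⇒x≡y x z∈⁅x⁆))) ]
            (x∈p∪q⁻ p ⁅ x ⁆ (p─q⊆p (p ∪ ⁅ x ⁆) ⁅ x ⁆ z∈))
  p⊆ : p ⊆ (p ∪ ⁅ x ⁆) - x
  p⊆ z∈p = x∈p∧x≢y⇒x∈p-y (p⊆p∪q ⁅ x ⁆ z∈p) (λ { refl → x∉p z∈p })

∣[p∪⁅y⁆]-x∣≡∣p∣ : ∀ {n} {x y : Fin n} {p} → x ∈ₛ p → y ∉ₛ p → ∣ (p ∪ ⁅ y ⁆) - x ∣ ≡ ∣ p ∣
∣[p∪⁅y⁆]-x∣≡∣p∣ {y = y} x∈p y∉p =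
  suc-injective (trans (x∈p⇒suc∣p-x∣≡∣p∣ (p⊆p∪q ⁅ y ⁆ x∈p)) (x∉p⇒∣p∪⁅x⁆∣≡suc∣p∣ y∉p))

∪⁅⁆-injective : ∀ {n} {S : Subset n} {a b} → a ∉ₛ S → S ∪ ⁅ a ⁆ ≡ S ∪ ⁅ b ⁆ → a ≡ b
∪⁅⁆-injective {S = S} {a} {b} a∉S eq =
  [ ⊥-elim ∘ a∉S , x∈⁅y⁆⇒x≡y b ] (x∈p∪q⁻ S ⁅ b ⁆ (subst (a ∈ₛ_) eq (q⊆p∪q S ⁅ a ⁆ (x∈⁅x⁆ a))))

elements : ∀ {n} → Subset n → List (Fin n)
elements [] = []
elements (inside ∷ p) = zero ∷ map suc (elements p)
elements (outside ∷ p) = map suc (elements p)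

length-elements : ∀ {n} (p : Subset n) → length (elements p) ≡ ∣ p ∣
length-elements [] = refl
length-elements (inside ∷ p) = cong suc (trans (length-map suc (elements p)) (length-elements p))
length-elements (outside ∷ p) = trans (length-map suc (elements p)) (length-elements p)

∈-elements⁺ : ∀ {n} {p : Subset n} {x} → x ∈ₛ p → x ∈ elements p
∈-elements⁺ {p = inside ∷ p} here = here refl
∈-elements⁺ {p = inside ∷ p} (there x∈p) = there (∈-map⁺ suc (∈-elements⁺ x∈p))
∈-elements⁺ {p = outside ∷ p} (there x∈p) = ∈-map⁺ suc (∈-elements⁺ x∈p)

∈-elements⁻ : ∀ {n} {p : Subset n} {x} → x ∈ elements p → x ∈ₛ p
∈-elements⁻ {p = inside ∷ p} (here refl) = here
∈-elements⁻ {p = inside ∷ p} (there x∈) with ∈-map⁻ suc x∈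
... | _ , y∈ , refl = there (∈-elements⁻ y∈)
∈-elements⁻ {p = outside ∷ p} x∈ with ∈-map⁻ suc x∈
... | _ , y∈ , refl = there (∈-elements⁻ y∈)

elements-unique : ∀ {n} (p : Subset n) → Unique (elements p)
elements-unique [] = []
elements-unique (inside ∷ p) =
  Allₚ.map⁺ (All.universal (λ _ ()) (elements p)) ∷ Unique.map⁺ fsuc-injective (elements-unique p)
elements-unique (outside ∷ p) = Unique.map⁺ fsuc-injective (elements-unique p)

-- Closure under elimination steps

Iter-base : ∀ {n} {F G : Family n} k {X} → G X → Iter F G k X
Iter-base zero G-X = G-X
Iter-base (suc k) G-X = inj₁ (Iter-base k G-X)

Step-mono : ∀ {n} {F P Q : Family n} → (∀ {X} → P X → Q X) → ∀ {X} → Step F P X → Step F Q X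
Step-mono P⊆Q (F-X , X₁ , X₂ , v , P-X₁ , P-X₂ , rest) = F-X , X₁ , X₂ , v , P⊆Q P-X₁ , P⊆Q P-X₂ , rest

Closure-induction : ∀ {n} {F G : Family n} (P : Family n) →
  (∀ {X} → G X → P X) → (∀ {X} → Step F P X → P X) → ∀ {X} → Closure F G X → P X
Closure-induction {F = F} {G} P base step (k , X∈) = go k X∈
  where
  go : ∀ k {X} → Iter F G k X → P X
  go zero = base
  go (suc k) (inj₁ X∈) = go k X∈
  go (suc k) (inj₂ X∈) = step (Step-mono {F = F} (go k) X∈)

-- Stars

∪⁅⁆-circuit : ∀ {n r} {S : Subset n} {a} → ∣ S ∣ ≡ r → a ∉ₛ S → UniformCircuits n r (S ∪ ⁅ a ⁆)
∪⁅⁆-circuit ∣S∣≡r a∉S = trans (x∉p⇒∣p∪⁅x⁆∣≡suc∣p∣ a∉S) (cong suc ∣S∣≡r)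

star : ∀ {n} → Subset n → List (Subset n)
star S = map (λ a → S ∪ ⁅ a ⁆) (elements (∁ S))

length-star : ∀ {n} (S : Subset n) → length (star S) ≡ n ∸ ∣ S ∣
length-star S = trans (length-map _ (elements (∁ S))) (trans (length-elements (∁ S)) (∣∁p∣≡n∸∣p∣ S))

∈-star⁺ : ∀ {n} {S : Subset n} {a} → a ∉ₛ S → S ∪ ⁅ a ⁆ ∈ star S
∈-star⁺ a∉S = ∈-map⁺ _ (∈-elements⁺ (x∉p⇒x∈∁p a∉S))

∈-star⁻ : ∀ {n} {S : Subset n} {X} → X ∈ star S → ∃ λ a → a ∉ₛ S × X ≡ S ∪ ⁅ a ⁆
∈-star⁻ X∈ with ∈-map⁻ _ X∈
... | a , a∈ , X≡ = a , x∈∁p⇒x∉p (∈-elements⁻ a∈) , X≡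

star-unique : ∀ {n} (S : Subset n) → Unique (star S)
star-unique S = AllPairs.map⁺ (distinct (elements-unique (∁ S)) (All.tabulate (x∈∁p⇒x∉p ∘ ∈-elements⁻)))
  where
  distinct : ∀ {as} → Unique as → All (_∉ₛ S) as → AllPairs (λ a b → S ∪ ⁅ a ⁆ ≢ S ∪ ⁅ b ⁆) as
  distinct [] [] = []
  distinct (a≢as ∷ as-unique) (a∉S ∷ as∉S) =
    All.map (λ a≢b → a≢b ∘ ∪⁅⁆-injective a∉S) a≢as ∷ distinct as-unique as∉S

module StarGenerator {n r : ℕ} (S : Subset n) (∣S∣≡r : ∣ S ∣ ≡ r) where

  Circuit : Family n
  Circuit = UniformCircuits n r

  star-circuits : All Circuit (star S)
  star-circuits = All.tabulate (λ {X} → star⊆circuits {X})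
    where
    star⊆circuits : ∀ {X} → X ∈ star S → Circuit X
    star⊆circuits X∈ with ∈-star⁻ X∈
    ... | a , a∉S , refl = ∪⁅⁆-circuit ∣S∣≡r a∉S

  ∣X∖S∣≡suc∣S∖X∣ : ∀ {X} → Circuit X → ∣ X ∩ ∁ S ∣ ≡ suc ∣ S ∩ ∁ X ∣
  ∣X∖S∣≡suc∣S∖X∣ {X} ∣X∣≡ = +-cancelʳ-≡ ∣ S ∣ _ _ (begin
    ∣ X ∩ ∁ S ∣ + ∣ S ∣      ≡⟨ ∣p∩∁q∣+∣q∣≡∣q∩∁p∣+∣p∣ X S ⟩
    ∣ S ∩ ∁ X ∣ + ∣ X ∣      ≡⟨ cong (∣ S ∩ ∁ X ∣ +_) (trans ∣X∣≡ (cong suc (sym ∣S∣≡r))) ⟩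
    ∣ S ∩ ∁ X ∣ + suc ∣ S ∣  ≡⟨ +-suc _ _ ⟩
    suc ∣ S ∩ ∁ X ∣ + ∣ S ∣  ∎)
    where open ≡-Reasoning

  star-member : ∀ {X} → Circuit X → ∣ S ∩ ∁ X ∣ ≡ 0 → X ∈ star S
  star-member {X} ∣X∣≡ ∣S∖X∣≡0
    with 0<∣p∣⇒Nonempty {p = X ∩ ∁ S} (subst (0 <_) (sym (∣X∖S∣≡suc∣S∖X∣ {X} ∣X∣≡)) (s≤s z≤n))
  ... | a , a∈X∖S = subst (_∈ star S) (p⊆q⇒∣q∣≤∣p∣⇒p≡q S∪a⊆X ∣X∣≤) (∈-star⁺ a∉S)
    where
    a∈X = proj₁ (x∈p∩q⁻ X (∁ S) a∈X∖S)
    a∉S = x∈∁p⇒x∉p (proj₂ (x∈p∩q⁻ X (∁ S) a∈X∖S))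
    S∪a⊆X : S ∪ ⁅ a ⁆ ⊆ X
    S∪a⊆X = ∪-least (∣p∩∁q∣≡0⇒p⊆q ∣S∖X∣≡0) (λ z∈⁅a⁆ → subst (_∈ₛ X) (sym (x∈⁅y⁆⇒x≡y a z∈⁅a⁆)) a∈X)
    ∣X∣≤ : ∣ X ∣ ≤ ∣ S ∪ ⁅ a ⁆ ∣
    ∣X∣≤ = ≤-reflexive (trans ∣X∣≡ (sym (∪⁅⁆-circuit ∣S∣≡r a∉S)))

  MissingAtMost : ℕ → Family n
  MissingAtMost d Y = Circuit Y × ∣ S ∩ ∁ Y ∣ ≤ d

  exchange-via : ∀ {X d a b v} → Circuit X → ∣ S ∩ ∁ X ∣ ≡ suc d →
                 a ∈ₛ X ∩ ∁ S → b ∈ₛ X ∩ ∁ S → a ≢ b → v ∈ₛ S ∩ ∁ X →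
                 Step Circuit (MissingAtMost d) X
  exchange-via {X} {d} {a} {b} {v} ∣X∣≡ ∣S∖X∣≡ a∈X∖S b∈X∖S a≢b v∈S∖X =
    ∣X∣≡ , Y - a , Y - b , v , removed a∈X∖S , removed b∈X∖S , Y-a≢Y-b ,
    x∈p∩q⁺ (v∈Y- a∈X∖S , v∈Y- b∈X∖S) , sym X≡
    where
    ∈X : ∀ {c} → c ∈ₛ X ∩ ∁ S → c ∈ₛ X
    ∈X = proj₁ ∘ x∈p∩q⁻ X (∁ S)
    ∉S : ∀ {c} → c ∈ₛ X ∩ ∁ S → c ∉ₛ S
    ∉S = x∈∁p⇒x∉p ∘ proj₂ ∘ x∈p∩q⁻ X (∁ S)
    v∈S = proj₁ (x∈p∩q⁻ S (∁ X) v∈S∖X)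
    v∉X = x∈∁p⇒x∉p (proj₂ (x∈p∩q⁻ S (∁ X) v∈S∖X))
    Y = X ∪ ⁅ v ⁆

    v∈Y- : ∀ {c} → c ∈ₛ X ∩ ∁ S → v ∈ₛ Y - c
    v∈Y- c∈X∖S = x∈p∧x≢y⇒x∈p-y (q⊆p∪q X ⁅ v ⁆ (x∈⁅x⁆ v)) (λ { refl → ∉S c∈X∖S v∈S })

    missing-shrinks : ∀ {c} → c ∈ₛ X ∩ ∁ S → S ∩ ∁ (Y - c) ⊆ (S ∩ ∁ X) - v
    missing-shrinks {c} c∈X∖S {z} z∈ = x∈p∧x≢y⇒x∈p-y (x∈p∩q⁺ (z∈S , x∉p⇒x∈∁p z∉X)) z≢v
      where
      z∈S = proj₁ (x∈p∩q⁻ S (∁ (Y - c)) z∈)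
      z∉Y-c = x∈∁p⇒x∉p (proj₂ (x∈p∩q⁻ S (∁ (Y - c)) z∈))
      z∉X : z ∉ₛ X
      z∉X z∈X = z∉Y-c (x∈p∧x≢y⇒x∈p-y (p⊆p∪q ⁅ v ⁆ z∈X) (λ { refl → ∉S c∈X∖S z∈S }))
      z≢v : z ≢ v
      z≢v refl = z∉Y-c (v∈Y- c∈X∖S)

    removed : ∀ {c} → c ∈ₛ X ∩ ∁ S → MissingAtMost d (Y - c)
    removed c∈X∖S =
      trans (∣[p∪⁅y⁆]-x∣≡∣p∣ (∈X c∈X∖S) v∉X) ∣X∣≡ ,
      ≤-trans (p⊆q⇒∣p∣≤∣q∣ (missing-shrinks c∈X∖S))
              (≤-reflexive (suc-injective (trans (x∈p⇒suc∣p-x∣≡∣p∣ v∈S∖X) ∣S∖X∣≡)))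

    Y-a≢Y-b : Y - a ≢ Y - b
    Y-a≢Y-b eq = x∈p-y⇒x≢y (subst (b ∈ₛ_) eq (x∈p∧x≢y⇒x∈p-y (p⊆p∪q ⁅ v ⁆ (∈X b∈X∖S)) (≢-sym a≢b))) refl

    X≡ : ((Y - a) ∪ (Y - b)) - v ≡ X
    X≡ = trans (cong (_- v) (p-x∪p-y≡p Y a≢b)) (x∉p⇒[p∪⁅x⁆]-x≡p v∉X)

  exchange : ∀ {X d} → Circuit X → ∣ S ∩ ∁ X ∣ ≡ suc d → Step Circuit (MissingAtMost d) X
  exchange {X} ∣X∣≡ ∣S∖X∣≡
    with 0<∣p∣⇒Nonempty {p = S ∩ ∁ X} (subst (0 <_) (sym ∣S∖X∣≡) (s≤s z≤n))
       | two-elements {p = X ∩ ∁ S}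
           (subst (2 ≤_) (sym (trans (∣X∖S∣≡suc∣S∖X∣ {X} ∣X∣≡) (cong suc ∣S∖X∣≡))) (s≤s (s≤s z≤n)))
  ... | _ , v∈S∖X | _ , _ , a∈X∖S , b∈X∖S , a≢b = exchange-via {X} ∣X∣≡ ∣S∖X∣≡ a∈X∖S b∈X∖S a≢b v∈S∖X

  generated : ∀ k {X} → Circuit X → ∣ S ∩ ∁ X ∣ ≤ k → Iter Circuit (ListFam (star S)) k X
  generated k {X} ∣X∣≡ _ with ∣ S ∩ ∁ X ∣ in ∣S∖X∣≡
  ... | zero = Iter-base k (star-member ∣X∣≡ ∣S∖X∣≡)
  generated (suc k) {X} ∣X∣≡ (s≤s d≤k) | suc d =
    inj₂ (Step-mono {F = Circuit} (λ {Y} (Y-circuit , m≤d) → generated k {Y} Y-circuit (≤-trans m≤d d≤k))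
                    (exchange {X} ∣X∣≡ ∣S∖X∣≡))

  isGenerator : IsGenerator Circuit (star S)
  isGenerator =
    star-unique S , star-circuits ,
    (λ _ → Closure-induction Circuit (All.lookup star-circuits) proj₁) ,
    (λ X ∣X∣≡ → r , generated r {X} ∣X∣≡ (≤-trans (∣p∩q∣≤∣p∣ S (∁ X)) (≤-reflexive ∣S∣≡r)))

-- Sparse covers

m+o≤n+p⇒m∸o≤[n∸o]+[p∸o] : ∀ o {m n p} → m + o ≤ n + p → o ≤ n → o ≤ p → m ∸ o ≤ (n ∸ o) + (p ∸ o)
m+o≤n+p⇒m∸o≤[n∸o]+[p∸o] zero {m} {n} {p} m+0≤n+p _ _ = subst (_≤ n + p) (+-identityʳ m) m+0≤n+p
m+o≤n+p⇒m∸o≤[n∸o]+[p∸o] (suc o) {zero} _ _ _ = z≤n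
m+o≤n+p⇒m∸o≤[n∸o]+[p∸o] (suc o) {suc m} {suc n} {suc p} m+o≤n+p (s≤s o≤n) (s≤s o≤p) =
  m+o≤n+p⇒m∸o≤[n∸o]+[p∸o] o (≤-pred (≤-pred (subst₂ _≤_ (cong suc (+-suc m o)) (cong suc (+-suc n p)) m+o≤n+p)))
    o≤n o≤p

module Blocks (r : ℕ) {n : ℕ} where

  Circuit : Family n
  Circuit = UniformCircuits n r

  excess : Subset n → ℕ
  excess B = ∣ B ∣ ∸ r

  totalExcess : List (Subset n) → ℕ
  totalExcess Bs = sum (map excess Bs)

  Meets Apart : Subset n → Subset n → Set
  Meets A B = r ≤ ∣ A ∩ B ∣
  Apart A B = ∣ A ∩ B ∣ < r

  Sparse : List (Subset n) → Set
  Sparse = AllPairs Apart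

  Covered : List (Subset n) → Subset n → Set
  Covered Bs X = Any (X ⊆_) Bs

  Covered-⊆ : ∀ {Bs X Y} → X ⊆ Y → Covered Bs Y → Covered Bs X
  Covered-⊆ X⊆Y = Any.map (⊆-trans X⊆Y)

  Meets-⊆ : ∀ {A A′ B B′} → A ⊆ A′ → B ⊆ B′ → Meets A B → Meets A′ B′
  Meets-⊆ {A} {A′} {B} {B′} A⊆A′ B⊆B′ r≤ = ≤-trans r≤ (p⊆q⇒∣p∣≤∣q∣ A∩B⊆)
    where
    A∩B⊆ : A ∩ B ⊆ A′ ∩ B′
    A∩B⊆ z∈ = x∈p∩q⁺ (A⊆A′ (proj₁ (x∈p∩q⁻ A B z∈)) , B⊆B′ (proj₂ (x∈p∩q⁻ A B z∈)))

  Meets-sym : ∀ {A B} → Meets A B → Meets B A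
  Meets-sym {A} {B} = subst (r ≤_) (cong ∣_∣ (∩-comm A B))

  excess-∪ : ∀ {A B} → Meets A B → excess (A ∪ B) ≤ excess A + excess B
  excess-∪ {A} {B} r≤∣A∩B∣ = m+o≤n+p⇒m∸o≤[n∸o]+[p∸o] r
    (subst (∣ A ∪ B ∣ + r ≤_) (∣p∪q∣+∣p∩q∣≡∣p∣+∣q∣ A B) (+-monoʳ-≤ ∣ A ∪ B ∣ r≤∣A∩B∣))
    (≤-trans r≤∣A∩B∣ (∣p∩q∣≤∣p∣ A B)) (≤-trans r≤∣A∩B∣ (∣p∩q∣≤∣q∣ A B))

  same-block : ∀ {P Q : Subset n → Set} {Bs} → Sparse Bs → Any P Bs → Any Q Bs →
               (∀ {B₁ B₂} → P B₁ → Q B₂ → Meets B₁ B₂) → Any (λ B → P B × Q B) Bs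
  same-block _ (here p) (here q) meet = here (p , q)
  same-block (apart ∷ _) (here p) (there qs) meet =
    ⊥-elim (All.lookupWith <⇒≱ apart (Any.map (meet p) qs))
  same-block {Bs = B ∷ _} (apart ∷ _) (there ps) (here q) meet =
    ⊥-elim (All.lookupWith <⇒≱ apart (Any.map (λ {B′} p → Meets-sym {B′} {B} (meet p q)) ps))
  same-block (_ ∷ sparse) (there ps) (there qs) meet = there (same-block sparse ps qs meet)

  record Extraction (B : Subset n) (Ns : List (Subset n)) : Set₁ where
    field
      block : Subset n
      rest : List (Subset n)
      meets : Meets B block
      rest-sparse : Sparse rest
      length-rest : suc (length rest) ≡ length Ns
      totalExcess-split : totalExcess Ns ≡ excess block + totalExcess rest
      covered-split : ∀ {X} → Covered Ns X → X ⊆ block ⊎ Covered rest X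
      All-rest : ∀ {P : Subset n → Set} → All P Ns → All P rest

  extract : ∀ B Ns → Sparse Ns → All (Apart B) Ns ⊎ Extraction B Ns
  extract B [] [] = inj₁ []
  extract B (N ∷ Ns) (N-apart ∷ Ns-sparse) with r ≤? ∣ B ∩ N ∣
  ... | yes B-meets-N = inj₂ record
    { block = N ; rest = Ns ; meets = B-meets-N ; rest-sparse = Ns-sparse
    ; length-rest = refl ; totalExcess-split = refl
    ; covered-split = Any.toSum
    ; All-rest = All.tail }
  ... | no B-misses-N with extract B Ns Ns-sparse
  ...   | inj₁ B-apart = inj₁ (≰⇒> B-misses-N ∷ B-apart)
  ...   | inj₂ e = inj₂ record
    { block = block ; rest = N ∷ rest ; meets = meets
    ; rest-sparse = All-rest {Apart N} N-apart ∷ rest-sparse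
    ; length-rest = cong suc length-rest
    ; totalExcess-split = trans (cong (excess N +_) totalExcess-split)
                                (x∙yz≈y∙xz (excess N) (excess block) (totalExcess rest))
    ; covered-split = [ inj₂ ∘ here , map₂ there ∘ covered-split ] ∘ Any.toSum
    ; All-rest = λ { (pN ∷ pNs) → pN ∷ All-rest pNs } }
    where open Extraction e

  record Insertion (B : Subset n) (Ns : List (Subset n)) : Set where
    field
      blocks : List (Subset n)
      sparse : Sparse blocks
      totalExcess-≤ : totalExcess blocks ≤ excess B + totalExcess Ns
      covers-new : Covered blocks B
      covers-old : ∀ {X} → Covered Ns X → Covered blocks X

  insert-bounded : ∀ k B Ns → length Ns ≤ k → Sparse Ns → Insertion B Ns
  insert-bounded k B Ns _ Ns-sparse with extract B Ns Ns-sparse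
  ... | inj₁ B-apart = record
    { blocks = B ∷ Ns ; sparse = B-apart ∷ Ns-sparse ; totalExcess-≤ = ≤-refl
    ; covers-new = here ⊆-refl ; covers-old = there }
  insert-bounded zero B Ns len≤0 _ | inj₂ e with subst (_≤ 0) (sym (Extraction.length-rest e)) len≤0
  ... | ()
  insert-bounded (suc k) B Ns len≤k _ | inj₂ e = record
    { blocks = R.blocks ; sparse = R.sparse ; totalExcess-≤ = totalExcess-≤
    ; covers-new = Covered-⊆ (p⊆p∪q block) R.covers-new
    ; covers-old = covers-old }
    where
    open Extraction e
    module R = Insertion (insert-bounded k (B ∪ block) rest
                           (≤-pred (subst (_≤ suc k) (sym length-rest) len≤k)) rest-sparse)
    covers-old : ∀ {X} → Covered Ns X → Covered R.blocks X
    covers-old X∈ with covered-split X∈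
    ... | inj₁ X⊆N = Covered-⊆ (⊆-trans X⊆N (q⊆p∪q B block)) R.covers-new
    ... | inj₂ X∈rest = R.covers-old X∈rest
    totalExcess-≤ : totalExcess R.blocks ≤ excess B + totalExcess Ns
    totalExcess-≤ = begin
      totalExcess R.blocks                          ≤⟨ R.totalExcess-≤ ⟩
      excess (B ∪ block) + totalExcess rest         ≤⟨ +-monoˡ-≤ (totalExcess rest) (excess-∪ {B} {block} meets) ⟩
      excess B + excess block + totalExcess rest    ≡⟨ +-assoc (excess B) _ _ ⟩
      excess B + (excess block + totalExcess rest)  ≡⟨ cong (excess B +_) totalExcess-split ⟨
      excess B + totalExcess Ns                     ∎
      where open ≤-Reasoning

  insert : ∀ B Ns → Sparse Ns → Insertion B Ns
  insert B Ns = insert-bounded (length Ns) B Ns ≤-refl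

  record SparseCover (G : List (Subset n)) : Set where
    field
      blocks : List (Subset n)
      sparse : Sparse blocks
      totalExcess-≤ : totalExcess blocks ≤ totalExcess G
      covers : ∀ {X} → X ∈ G → Covered blocks X

  sparseCover : ∀ G → SparseCover G
  sparseCover [] = record { blocks = [] ; sparse = [] ; totalExcess-≤ = z≤n ; covers = λ () }
  sparseCover (X ∷ G) = record
    { blocks = I.blocks ; sparse = I.sparse
    ; totalExcess-≤ = ≤-trans I.totalExcess-≤ (+-monoʳ-≤ (excess X) C.totalExcess-≤)
    ; covers = λ { (here refl) → I.covers-new ; (there X∈G) → I.covers-old (C.covers X∈G) } }
    where
    module C = SparseCover (sparseCover G)
    module I = Insertion (insert X C.blocks C.sparse)

  totalExcess-circuits : ∀ {G} → All Circuit G → totalExcess G ≡ length G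
  totalExcess-circuits [] = refl
  totalExcess-circuits (∣X∣≡ ∷ G-circuits) =
    cong₂ _+_ (trans (cong (_∸ r) ∣X∣≡) (m+n∸n≡m 1 r)) (totalExcess-circuits G-circuits)

  ≤-totalExcess : ∀ {k Bs} → Any (λ B → k ≤ excess B) Bs → k ≤ totalExcess Bs
  ≤-totalExcess {Bs = B ∷ Bs} (here k≤) = ≤-trans k≤ (m≤m+n (excess B) (totalExcess Bs))
  ≤-totalExcess {Bs = B ∷ Bs} (there k≤) = ≤-trans (≤-totalExcess k≤) (m≤n+m (totalExcess Bs) (excess B))

  step-circuits-meet : ∀ {X₁ X₂ v} → Circuit X₁ → Circuit X₂ → v ∈ₛ X₁ ∩ X₂ →
                       Circuit ((X₁ ∪ X₂) - v) → Meets X₁ X₂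
  step-circuits-meet {X₁} {X₂} ∣X₁∣≡ ∣X₂∣≡ v∈X₁∩X₂ ∣X∣≡ =
    ≤-reflexive (sym (+-cancelˡ-≡ (suc (suc r)) _ _ (begin
      suc (suc r) + ∣ X₁ ∩ X₂ ∣  ≡⟨ cong (_+ ∣ X₁ ∩ X₂ ∣) ∣X₁∪X₂∣≡ ⟨
      ∣ X₁ ∪ X₂ ∣ + ∣ X₁ ∩ X₂ ∣  ≡⟨ ∣p∪q∣+∣p∩q∣≡∣p∣+∣q∣ X₁ X₂ ⟩
      ∣ X₁ ∣ + ∣ X₂ ∣            ≡⟨ cong₂ _+_ ∣X₁∣≡ ∣X₂∣≡ ⟩
      suc r + suc r              ≡⟨ cong suc (+-suc r r) ⟩
      suc (suc r) + r            ∎)))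
    where
    open ≡-Reasoning
    ∣X₁∪X₂∣≡ : ∣ X₁ ∪ X₂ ∣ ≡ suc (suc r)
    ∣X₁∪X₂∣≡ = trans (sym (x∈p⇒suc∣p-x∣≡∣p∣ (p⊆p∪q X₂ (proj₁ (x∈p∩q⁻ X₁ X₂ v∈X₁∩X₂))))) (cong suc ∣X∣≡)

  closure-covered : ∀ {G} → All Circuit G → (C : SparseCover G) →
                    ∀ {X} → Closure Circuit (ListFam G) X → Covered (SparseCover.blocks C) X
  closure-covered G-circuits C =
    proj₂ ∘ Closure-induction CoveredCircuit (λ X∈G → All.lookup G-circuits X∈G , covers X∈G) step
    where
    open SparseCover C
    CoveredCircuit : Family n
    CoveredCircuit X = Circuit X × Covered blocks X
    step : ∀ {X} → Step Circuit CoveredCircuit X → CoveredCircuit X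
    step (∣X∣≡ , X₁ , X₂ , v , (∣X₁∣≡ , X₁∈) , (∣X₂∣≡ , X₂∈) , _ , v∈X₁∩X₂ , refl) =
      ∣X∣≡ , Any.map contains (same-block sparse X₁∈ X₂∈ (λ X₁⊆B₁ X₂⊆B₂ → Meets-⊆ X₁⊆B₁ X₂⊆B₂ X₁-meets-X₂))
      where
      X₁-meets-X₂ = step-circuits-meet {X₁} {X₂} ∣X₁∣≡ ∣X₂∣≡ v∈X₁∩X₂ ∣X∣≡
      contains : ∀ {B} → X₁ ⊆ B × X₂ ⊆ B → (X₁ ∪ X₂) - v ⊆ B
      contains (X₁⊆B , X₂⊆B) = ⊆-trans (p─q⊆p (X₁ ∪ X₂) ⁅ v ⁆) (∪-least X₁⊆B X₂⊆B)

  full-block : r < n → ∀ {Bs} → Sparse Bs → (∀ {X} → Circuit X → Covered Bs X) → Any (⊤ ⊆_) Bs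
  full-block r<n {Bs} Bs-sparse circuits-covered = Any.map full (block-through (allFin n))
    where
    S = proj₁ (∃-∣p∣≡k (<⇒≤ r<n))
    ∣S∣≡r = proj₂ (∃-∣p∣≡k (<⇒≤ r<n))
    a₀-witness = 0<∣p∣⇒Nonempty {p = ∁ S}
      (subst (0 <_) (sym (trans (∣∁p∣≡n∸∣p∣ S) (cong (n ∸_) ∣S∣≡r))) (m<n⇒0<n∸m r<n))
    a₀ = proj₁ a₀-witness
    a₀∉S = x∈∁p⇒x∉p (proj₂ a₀-witness)

    circuit-through : ∀ x → ∃ λ K → Circuit K × S ⊆ K × x ∈ₛ K
    circuit-through x with x ∈? S
    ... | yes x∈S = S ∪ ⁅ a₀ ⁆ , ∪⁅⁆-circuit ∣S∣≡r a₀∉S , p⊆p∪q ⁅ a₀ ⁆ , p⊆p∪q ⁅ a₀ ⁆ x∈S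
    ... | no x∉S = S ∪ ⁅ x ⁆ , ∪⁅⁆-circuit ∣S∣≡r x∉S , p⊆p∪q ⁅ x ⁆ , q⊆p∪q S ⁅ x ⁆ (x∈⁅x⁆ x)

    full : ∀ {B} → S ⊆ B × All (_∈ₛ B) (allFin n) → ⊤ ⊆ B
    full (_ , all∈B) {x} _ = All.lookup all∈B (∈-allFin x)

    S-meets-S : Meets S S
    S-meets-S = ≤-reflexive (sym (trans (cong ∣_∣ (∩-idem S)) ∣S∣≡r))

    block-through : ∀ xs → Any (λ B → S ⊆ B × All (_∈ₛ B) xs) Bs
    block-through [] with circuit-through a₀
    ... | K , K-circuit , S⊆K , _ = Any.map start (circuits-covered {K} K-circuit)
      where
      start : ∀ {B} → K ⊆ B → S ⊆ B × All (_∈ₛ B) []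
      start K⊆B = ⊆-trans S⊆K K⊆B , []
    block-through (x ∷ xs) with circuit-through x
    ... | K , K-circuit , S⊆K , x∈K =
      Any.map extend (same-block Bs-sparse (block-through xs) (circuits-covered {K} K-circuit) meet)
      where
      extend : ∀ {B} → (S ⊆ B × All (_∈ₛ B) xs) × K ⊆ B → S ⊆ B × All (_∈ₛ B) (x ∷ xs)
      extend ((S⊆B , xs⊆B) , K⊆B) = S⊆B , K⊆B x∈K ∷ xs⊆B
      meet : ∀ {B₁ B₂} → S ⊆ B₁ × All (_∈ₛ B₁) xs → K ⊆ B₂ → Meets B₁ B₂
      meet (S⊆B₁ , _) K⊆B₂ = Meets-⊆ S⊆B₁ (⊆-trans S⊆K K⊆B₂) S-meets-S

  generator-length : r ≤ n → ∀ G → IsGenerator Circuit G → n ∸ r ≤ length G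
  generator-length r≤n G (_ , G-circuits , _ , circuits⊆closure) with m≤n⇒m<n∨m≡n r≤n
  ... | inj₂ refl = subst (_≤ length G) (sym (n∸n≡0 r)) z≤n
  ... | inj₁ r<n = begin
    n ∸ r               ≤⟨ ≤-totalExcess (Any.map full⇒n∸r≤ (full-block r<n sparse covered)) ⟩
    totalExcess blocks  ≤⟨ totalExcess-≤ ⟩
    totalExcess G       ≡⟨ totalExcess-circuits G-circuits ⟩
    length G            ∎
    where
    open ≤-Reasoning
    open SparseCover (sparseCover G)
    covered : ∀ {X} → Circuit X → Covered blocks X
    covered {X} X-circuit = closure-covered G-circuits (sparseCover G) (circuits⊆closure X X-circuit)
    full⇒n∸r≤ : ∀ {B} → ⊤ ⊆ B → n ∸ r ≤ excess B
    full⇒n∸r≤ {B} ⊤⊆B = ∸-monoˡ-≤ r (subst (_≤ ∣ B ∣) (∣⊤∣≡n n) (p⊆q⇒∣p∣≤∣q∣ ⊤⊆B))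

theorem19 : (r n : ℕ) → 1 ≤ r → r ≤ n →
    (Σ (List (Subset n)) λ G → IsGenerator (UniformCircuits n r) G × length G ≡ n ∸ r)
    × ((G : List (Subset n)) → IsGenerator (UniformCircuits n r) G → n ∸ r ≤ length G)
theorem19 r n _ r≤n with ∃-∣p∣≡k r≤n
... | S , ∣S∣≡r =
  (star S , StarGenerator.isGenerator S ∣S∣≡r , trans (length-star S) (cong (n ∸_) ∣S∣≡r)) ,
  Blocks.generator-length r r≤n
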